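{- Let $t$ be a CBN term, $u'$ a Bang term, $F$ a full context of the Distant Bang Calculus and $R'\in\{dB,s!,d!\}$. If $t^{n} \to_{F\langle R'\rangle} u'$, then there exist a CBN term $u$ with $u^{n}=u'$, a rule $R\in\{dB,s\}$ with $R^{n}=R'$, and a CBN full context $G$ with $G^{n}=F$, such that $t \to_{G\langle R\rangle} u$.
   Context: Distant Bang Calculus. Terms: $t,u,s ::= x \mid t\,u \mid \lambda x.t \mid !t \mid \mathrm{der}(t) \mid t[x\backslash u]$; $\lambda x.t$ and $t[x\backslash u]$ bind $x$ in $t$; terms up to $\alpha$-conversion; $t\{x:=u\}$ is capture-avoiding substitution. Contexts have exactly one hole $\square$, $C\langle t\rangle$ is plugging. Full contexts: $F ::= \square \mid F\,t \mid t\,F \mid \lambda x.F \mid !F \mid \mathrm{der}(F) \mid F[x\backslash t] \mid t[x\backslash F]$; list contexts $L ::= \square \mid L[x\backslash t]$. Rules (capture-free w.r.t. $L$): $(dB)$ $L\langle \lambda x.t\rangle\,u \mapsto L\langle t[x\backslash u]\rangle$; $(s!)$ $t[x\backslash L\langle !u\rangle] \mapsto L\langle t\{x:=u\}\rangle$; $(d!)$ $\mathrm{der}(L\langle !t\rangle) \mapsto L\langle t\rangle$. For a context $C$ and rule $R$, $C\langle t\rangle \to_{C\langle R\rangle} C\langle u\rangle$ whenever $t\mapsto_R u$. CBN calculus. Terms $t,u ::= x \mid \lambda x.t \mid t\,u \mid t[x\backslash u]$; full contexts $G ::= \square \mid G\,t \mid t\,G \mid \lambda x.G \mid G[x\backslash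 t] \mid t[x\backslash G]$; list contexts $L ::= \square \mid L[x\backslash t]$. Rules: $(dB)$ $L\langle \lambda x.t\rangle\,u \mapsto L\langle t[x\backslash u]\rangle$ (capture-free), $(s)$ $t[x\backslash u]\mapsto t\{x:=u\}$; $t\to_{G\langle R\rangle}u$ means $t=G\langle t'\rangle$, $u=G\langle u'\rangle$, $t'\mapsto_R u'$. CBN embedding $(\cdot)^n$: $x^n=x$, $(\lambda x.t)^n=\lambda x.t^n$, $(t\,u)^n=t^n\,!u^n$, $(t[x\backslash u])^n=t^n[x\backslash !u^n]$; on contexts by the same clauses with $\square^n=\square$; on rule names $dB^n=dB$, $s^n=s!$. -}

module Defs where

open import Data.Nat using (ℕ; zero; suc; _+_)
open import Data.Product using (Σ; _×_; _,_)
open import Relation.Binary.PropositionalEquality using (_≡_)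

-- In  lam t  and  es t u  (= t[x\u]) the index 0 in t refers to the bound x.

data BTerm : Set where
  var  : ℕ → BTerm
  app  : BTerm → BTerm → BTerm
  lam  : BTerm → BTerm
  bang : BTerm → BTerm
  der  : BTerm → BTerm
  es   : BTerm → BTerm → BTerm

extB : (ℕ → ℕ) → ℕ → ℕ
extB ρ zero    = zero
extB ρ (suc i) = suc (ρ i)

renB : (ℕ → ℕ) → BTerm → BTerm
renB ρ (var i)  = var (ρ i)
renB ρ (app t u) = app (renB ρ t) (renB ρ u)
renB ρ (lam t)  = lam (renB (extB ρ) t)
renB ρ (bang t) = bang (renB ρ t)
renB ρ (der t)  = der (renB ρ t)
renB ρ (es t u) = es (renB (extB ρ) t) (renB ρ u)

extsB : (ℕ → BTerm) → ℕ → BTerm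
extsB σ zero    = var zero
extsB σ (suc i) = renB suc (σ i)

subB : (ℕ → BTerm) → BTerm → BTerm
subB σ (var i)  = σ i
subB σ (app t u) = app (subB σ t) (subB σ u)
subB σ (lam t)  = lam (subB (extsB σ) t)
subB σ (bang t) = bang (subB σ t)
subB σ (der t)  = der (subB σ t)
subB σ (es t u) = es (subB (extsB σ) t) (subB σ u)

data BCtx : Set where
  hole  : BCtx
  appL  : BCtx → BTerm → BCtx
  appR  : BTerm → BCtx → BCtx
  lamC  : BCtx → BCtx
  bangC : BCtx → BCtx
  derC  : BCtx → BCtx
  esL   : BCtx → BTerm → BCtx
  esR   : BTerm → BCtx → BCtx

plugB : BCtx → BTerm → BTerm
plugB hole      s = s
plugB (appL F t) s = app (plugB F s) t
plugB (appR t F) s = app t (plugB F s)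
plugB (lamC F)  s = lam (plugB F s)
plugB (bangC F) s = bang (plugB F s)
plugB (derC F)  s = der (plugB F s)
plugB (esL F t) s = es (plugB F s) t
plugB (esR t F) s = es t (plugB F s)

-- list contexts L ::= □ | L[x\t], as the list of the substituted terms
-- (innermost first);  plugLB L t  places t under all binders of L.
data BLCtx : Set where
  lhole : BLCtx
  lsub  : BLCtx → BTerm → BLCtx

plugLB : BLCtx → BTerm → BTerm
plugLB lhole      s = s
plugLB (lsub L t) s = es (plugLB L s) t

lenB : BLCtx → ℕ
lenB lhole      = zero
lenB (lsub L _) = suc (lenB L)

data BRule : Set where
  dB s! d! : BRule

-- root rules; "capture-free w.r.t. L" is realised by shifting the
-- parts that move under the binders of L by the length of L.
data BRoot : BRule → BTerm → BTerm → Set where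
  r-dB : ∀ L t u →
    BRoot dB (app (plugLB L (lam t)) u) (plugLB L (es t (renB (lenB L +_) u)))
  r-s! : ∀ t L u →
    BRoot s! (es t (plugLB L (bang u)))
             (plugLB L (subB (λ { zero → u ; (suc i) → var (lenB L + i) }) t))
  r-d! : ∀ L t →
    BRoot d! (der (plugLB L (bang t))) (plugLB L t)

BStep : BCtx → BRule → BTerm → BTerm → Set
BStep F R t u = Σ BTerm λ t′ → Σ BTerm λ u′ →
  (t ≡ plugB F t′) × (u ≡ plugB F u′) × BRoot R t′ u′

data NTerm : Set where
  var : ℕ → NTerm
  lam : NTerm → NTerm
  app : NTerm → NTerm → NTerm
  es  : NTerm → NTerm → NTerm

renN : (ℕ → ℕ) → NTerm → NTerm
renN ρ (var i)  = var (ρ i)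
renN ρ (lam t)  = lam (renN (extB ρ) t)
renN ρ (app t u) = app (renN ρ t) (renN ρ u)
renN ρ (es t u) = es (renN (extB ρ) t) (renN ρ u)

extsN : (ℕ → NTerm) → ℕ → NTerm
extsN σ zero    = var zero
extsN σ (suc i) = renN suc (σ i)

subN : (ℕ → NTerm) → NTerm → NTerm
subN σ (var i)  = σ i
subN σ (lam t)  = lam (subN (extsN σ) t)
subN σ (app t u) = app (subN σ t) (subN σ u)
subN σ (es t u) = es (subN (extsN σ) t) (subN σ u)

data NCtx : Set where
  hole : NCtx
  appL : NCtx → NTerm → NCtx
  appR : NTerm → NCtx → NCtx
  lamC : NCtx → NCtx
  esL  : NCtx → NTerm → NCtx
  esR  : NTerm → NCtx → NCtx

plugN : NCtx → NTerm → NTerm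
plugN hole      s = s
plugN (appL G t) s = app (plugN G s) t
plugN (appR t G) s = app t (plugN G s)
plugN (lamC G)  s = lam (plugN G s)
plugN (esL G t) s = es (plugN G s) t
plugN (esR t G) s = es t (plugN G s)

data NLCtx : Set where
  lhole : NLCtx
  lsub  : NLCtx → NTerm → NLCtx

plugLN : NLCtx → NTerm → NTerm
plugLN lhole      s = s
plugLN (lsub L t) s = es (plugLN L s) t

lenN : NLCtx → ℕ
lenN lhole      = zero
lenN (lsub L _) = suc (lenN L)

data NRule : Set where
  dB s : NRule

data NRoot : NRule → NTerm → NTerm → Set where
  r-dB : ∀ L t u →
    NRoot dB (app (plugLN L (lam t)) u) (plugLN L (es t (renN (lenN L +_) u)))
  r-s : ∀ t u →
    NRoot s (es t u) (subN (λ { zero → u ; (suc i) → var i }) t)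

NStep : NCtx → NRule → NTerm → NTerm → Set
NStep G R t u = Σ NTerm λ t′ → Σ NTerm λ u′ →
  (t ≡ plugN G t′) × (u ≡ plugN G u′) × NRoot R t′ u′

embT : NTerm → BTerm
embT (var i)  = var i
embT (lam t)  = lam (embT t)
embT (app t u) = app (embT t) (bang (embT u))
embT (es t u) = es (embT t) (bang (embT u))

embC : NCtx → BCtx
embC hole      = hole
embC (appL G t) = appL (embC G) (bang (embT t))
embC (appR t G) = appR (embT t) (bangC (embC G))
embC (lamC G)  = lamC (embC G)
embC (esL G t) = esL (embC G) (bang (embT t))
embC (esR t G) = esR (embT t) (bangC (embC G))

embR : NRule → BRule
embR dB = dB
embR s  = s!

{-# OPTIONS --safe #-}
module Submission where

open import Defs
open import Data.Nat using (zero; suc; _+_)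
open import Data.Empty using (⊥-elim)
open import Data.Product using (Σ; _×_; _,_)
open import Relation.Binary.PropositionalEquality
  using (_≡_; _≢_; refl; cong; cong₂; sym; trans; module ≡-Reasoning)

-- A Bang redex is never of the form !s, while the only ! nodes of tⁿ wrap
-- arguments and explicitly substituted terms; hence a redex of tⁿ occurs at
-- a position Gⁿ and is itself vⁿ for a subterm v of t. There a dB redex
-- L⟨λx.r⟩ s pulls back along the embedding of list contexts, an s! redex has
-- an empty list context because the substituted term is literally !wⁿ, and
-- d! redexes cannot occur because tⁿ contains no der.

app-injective : ∀ {a b c d} → BTerm.app a b ≡ app c d → (a ≡ c) × (b ≡ d)
app-injective refl = refl , refl

es-injective : ∀ {a b c d} → BTerm.es a b ≡ es c d → (a ≡ c) × (b ≡ d)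
es-injective refl = refl , refl

lam-injective : ∀ {a c} → BTerm.lam a ≡ lam c → a ≡ c
lam-injective refl = refl

bang-injective : ∀ {a c} → BTerm.bang a ≡ bang c → a ≡ c
bang-injective refl = refl

root-not-bang : ∀ {R z z′} → BRoot R z z′ → ∀ x → z ≢ bang x
root-not-bang () x refl

embT-renN : ∀ ρ t → embT (renN ρ t) ≡ renB ρ (embT t)
embT-renN ρ (var i)   = refl
embT-renN ρ (lam t)   = cong lam (embT-renN (extB ρ) t)
embT-renN ρ (app t u) = cong₂ app (embT-renN ρ t) (cong bang (embT-renN ρ u))
embT-renN ρ (es t u)  = cong₂ es (embT-renN (extB ρ) t) (cong bang (embT-renN ρ u))

embT-extsN : ∀ {σ τ} → (∀ i → embT (σ i) ≡ τ i) → ∀ i → embT (extsN σ i) ≡ extsB τ i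
embT-extsN σ≗τ zero        = refl
embT-extsN {σ} σ≗τ (suc i) = trans (embT-renN suc (σ i)) (cong (renB suc) (σ≗τ i))

embT-subN : ∀ {σ τ} → (∀ i → embT (σ i) ≡ τ i) → ∀ t → embT (subN σ t) ≡ subB τ (embT t)
embT-subN σ≗τ (var i)   = σ≗τ i
embT-subN σ≗τ (lam t)   = cong lam (embT-subN (embT-extsN σ≗τ) t)
embT-subN σ≗τ (app t u) = cong₂ app (embT-subN σ≗τ t) (cong bang (embT-subN σ≗τ u))
embT-subN σ≗τ (es t u)  =
  cong₂ es (embT-subN (embT-extsN σ≗τ) t) (cong bang (embT-subN σ≗τ u))

embT-plugN : ∀ G v → embT (plugN G v) ≡ plugB (embC G) (embT v)
embT-plugN hole       v = refl
embT-plugN (appL G t) v = cong (λ w → app w (bang (embT t))) (embT-plugN G v)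
embT-plugN (appR t G) v = cong (λ w → app (embT t) (bang w)) (embT-plugN G v)
embT-plugN (lamC G)   v = cong lam (embT-plugN G v)
embT-plugN (esL G t)  v = cong (λ w → es w (bang (embT t))) (embT-plugN G v)
embT-plugN (esR t G)  v = cong (λ w → es (embT t) (bang w)) (embT-plugN G v)

embL : NLCtx → BLCtx
embL lhole      = lhole
embL (lsub L t) = lsub (embL L) (bang (embT t))

lenB-embL : ∀ L → lenB (embL L) ≡ lenN L
lenB-embL lhole      = refl
lenB-embL (lsub L _) = cong suc (lenB-embL L)

embT-plugLN : ∀ L v → embT (plugLN L v) ≡ plugLB (embL L) (embT v)
embT-plugLN lhole      v = refl
embT-plugLN (lsub L t) v = cong (λ w → es w (bang (embT t))) (embT-plugLN L v)

embT-plugLB-inv : ∀ a L {z} → embT a ≡ plugLB L z →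
  Σ NLCtx λ L′ → Σ NTerm λ a′ → (a ≡ plugLN L′ a′) × (embL L′ ≡ L) × (embT a′ ≡ z)
embT-plugLB-inv a         lhole      eq = lhole , a , refl , refl , eq
embT-plugLB-inv (es a c)  (lsub L b) eq with es-injective eq
... | eqa , refl with embT-plugLB-inv a L eqa
...   | L′ , a′ , refl , refl , eqa′ = lsub L′ c , a′ , refl , refl , eqa′
embT-plugLB-inv (var _)   (lsub L b) ()
embT-plugLB-inv (lam _)   (lsub L b) ()
embT-plugLB-inv (app _ _) (lsub L b) ()

embT-lam-inv : ∀ a {x} → embT a ≡ lam x → Σ NTerm λ a′ → (a ≡ lam a′) × (embT a′ ≡ x)
embT-lam-inv (lam a)   eq = a , refl , lam-injective eq
embT-lam-inv (var _)   ()
embT-lam-inv (app _ _) ()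
embT-lam-inv (es _ _)  ()

simulate-root : ∀ t {R′ z z′} → embT t ≡ z → BRoot R′ z z′ →
  Σ NTerm λ u → Σ NRule λ R → (embT u ≡ z′) × (embR R ≡ R′) × NRoot R t u
simulate-root (app a c) eq (r-dB L x _) with app-injective eq
... | eqa , refl with embT-plugLB-inv a L eqa
...   | L′ , a′ , refl , refl , eqa′ with embT-lam-inv a′ eqa′
...     | x′ , refl , refl = _ , dB , embT-contractum , refl , r-dB L′ x′ c
  where
    open ≡-Reasoning
    embT-contractum : embT (plugLN L′ (es x′ (renN (lenN L′ +_) c)))
                    ≡ plugLB (embL L′) (es (embT x′) (renB (lenB (embL L′) +_) (bang (embT c))))
    embT-contractum = begin
      embT (plugLN L′ (es x′ (renN (lenN L′ +_) c)))
        ≡⟨ embT-plugLN L′ _ ⟩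
      plugLB (embL L′) (es (embT x′) (bang (embT (renN (lenN L′ +_) c))))
        ≡⟨ cong (λ w → plugLB (embL L′) (es (embT x′) (bang w))) (embT-renN (lenN L′ +_) c) ⟩
      plugLB (embL L′) (es (embT x′) (bang (renB (lenN L′ +_) (embT c))))
        ≡⟨ cong (λ k → plugLB (embL L′) (es (embT x′) (bang (renB (k +_) (embT c)))))
                (sym (lenB-embL L′)) ⟩
      plugLB (embL L′) (es (embT x′) (bang (renB (lenB (embL L′) +_) (embT c))))
        ∎
simulate-root (es a c) eq (r-s! _ lhole _) with es-injective eq
... | refl , refl = _ , s , embT-subN (λ { zero → refl ; (suc i) → refl }) a , refl , r-s a c
simulate-root (es a c) eq (r-s! _ (lsub L _) _) with es-injective eq
... | _ , ()
simulate-root (var _)   () (r-dB _ _ _)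
simulate-root (lam _)   () (r-dB _ _ _)
simulate-root (es _ _)  () (r-dB _ _ _)
simulate-root (var _)   () (r-s! _ _ _)
simulate-root (lam _)   () (r-s! _ _ _)
simulate-root (app _ _) () (r-s! _ _ _)
simulate-root (var _)   () (r-d! _ _)
simulate-root (lam _)   () (r-d! _ _)
simulate-root (app _ _) () (r-d! _ _)
simulate-root (es _ _)  () (r-d! _ _)

bang-plugB-inv : ∀ F {x z} → (∀ y → z ≢ bang y) → bang x ≡ plugB F z →
  Σ BCtx λ F′ → (F ≡ bangC F′) × (x ≡ plugB F′ z)
bang-plugB-inv hole      z≢! eq = ⊥-elim (z≢! _ (sym eq))
bang-plugB-inv (bangC F) z≢! eq = F , refl , bang-injective eq
bang-plugB-inv (appL _ _) z≢! ()
bang-plugB-inv (appR _ _) z≢! ()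
bang-plugB-inv (lamC _)   z≢! ()
bang-plugB-inv (derC _)   z≢! ()
bang-plugB-inv (esL _ _)  z≢! ()
bang-plugB-inv (esR _ _)  z≢! ()

embT-plugB-inv : ∀ t F {z} → (∀ y → z ≢ bang y) → embT t ≡ plugB F z →
  Σ NCtx λ G → Σ NTerm λ v → (t ≡ plugN G v) × (embC G ≡ F) × (embT v ≡ z)
embT-plugB-inv t hole z≢! eq = hole , t , refl , refl , eq
embT-plugB-inv (lam a) (lamC F) z≢! eq with embT-plugB-inv a F z≢! (lam-injective eq)
... | G , v , refl , refl , eqv = lamC G , v , refl , refl , eqv
embT-plugB-inv (app a c) (appL F b) z≢! eq with app-injective eq
... | eqa , refl with embT-plugB-inv a F z≢! eqa
...   | G , v , refl , refl , eqv = appL G c , v , refl , refl , eqv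
embT-plugB-inv (app a c) (appR b F) z≢! eq with app-injective eq
... | refl , eqc with bang-plugB-inv F z≢! eqc
...   | F′ , refl , eqc′ with embT-plugB-inv c F′ z≢! eqc′
...     | G , v , refl , refl , eqv = appR a G , v , refl , refl , eqv
embT-plugB-inv (es a c) (esL F b) z≢! eq with es-injective eq
... | eqa , refl with embT-plugB-inv a F z≢! eqa
...   | G , v , refl , refl , eqv = esL G c , v , refl , refl , eqv
embT-plugB-inv (es a c) (esR b F) z≢! eq with es-injective eq
... | refl , eqc with bang-plugB-inv F z≢! eqc
...   | F′ , refl , eqc′ with embT-plugB-inv c F′ z≢! eqc′
...     | G , v , refl , refl , eqv = esR a G , v , refl , refl , eqv
embT-plugB-inv (var _)   (appL _ _) _ ()
embT-plugB-inv (var _)   (appR _ _) _ ()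
embT-plugB-inv (var _)   (lamC _)   _ ()
embT-plugB-inv (var _)   (bangC _)  _ ()
embT-plugB-inv (var _)   (derC _)   _ ()
embT-plugB-inv (var _)   (esL _ _)  _ ()
embT-plugB-inv (var _)   (esR _ _)  _ ()
embT-plugB-inv (lam _)   (appL _ _) _ ()
embT-plugB-inv (lam _)   (appR _ _) _ ()
embT-plugB-inv (lam _)   (bangC _)  _ ()
embT-plugB-inv (lam _)   (derC _)   _ ()
embT-plugB-inv (lam _)   (esL _ _)  _ ()
embT-plugB-inv (lam _)   (esR _ _)  _ ()
embT-plugB-inv (app _ _) (lamC _)   _ ()
embT-plugB-inv (app _ _) (bangC _)  _ ()
embT-plugB-inv (app _ _) (derC _)   _ ()
embT-plugB-inv (app _ _) (esL _ _)  _ ()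
embT-plugB-inv (app _ _) (esR _ _)  _ ()
embT-plugB-inv (es _ _)  (appL _ _) _ ()
embT-plugB-inv (es _ _)  (appR _ _) _ ()
embT-plugB-inv (es _ _)  (lamC _)   _ ()
embT-plugB-inv (es _ _)  (bangC _)  _ ()
embT-plugB-inv (es _ _)  (derC _)   _ ()

lemma3 : (t : NTerm) (u′ : BTerm) (F : BCtx) (R′ : BRule) →
    BStep F R′ (embT t) u′ →
    Σ NTerm λ u → Σ NRule λ R → Σ NCtx λ G →
    (embT u ≡ u′) × (embR R ≡ R′) × (embC G ≡ F) × NStep G R t u
lemma3 t u′ F R′ (z , z′ , eq , refl , r) with embT-plugB-inv t F (root-not-bang r) eq
... | G , v , refl , refl , refl with simulate-root v refl r
...   | u , R , refl , refl , v↦u =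
  plugN G u , R , G , embT-plugN G u , refl , refl , v , u , refl , refl , v↦u
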